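{- Let $D=(V,A)$ be a directed graph (loops and multiple arcs allowed) with $\mathrm{comp}(D)$ connected components. Then for every odd positive integer $q$, \[\mathcal{A}_{D}(q,y,z)=\frac{1}{q^{\mathrm{comp}(D)}}\sum_{f:V\to\{1,\ldots,q\}} y^{\#\{(u,v)\in A:\ f(v)-f(u)\in S_q\}}\,z^{\#\{(u,v)\in A:\ f(u)-f(v)\in S_q\}},\] where $S_q=\{1,2,\ldots,\lfloor q/2\rfloor\}\cup\{ -q+1,-q+2,\ldots,-q+\lfloor q/2\rfloor\}$.
   Context: For a digraph $D=(V,A)$, $N_D$ is the (regular) oriented matroid on ground set $A$ represented by the incidence matrix of $D$ (entries $r_{v,a}=\mathbb{1}[v\text{ is the end of }a]-\mathbb{1}[v\text{ is the origin of }a]$); its signed circuits correspond to the simple cycles of the underlying graph with a direction of traversal, $C^+$ being the arcs traversed forwards and $C^-$ those traversed backwards. For a regular oriented matroid $N=(A,\mathfrak{C})$ and positive integer $q$, a $q$-coflow is a map $f:A\to\mathbb{Z}/q\mathbb{Z}$ with $\sum_{a\in C^+}f(a)-\sum_{a\in C^- }f(a)=0$ for all signed circuits $C$; $f_A^>$ (resp. $f_A^<$) is the set of $a$ with $f(a)$ (resp. $-f(a)$) congruent mod $q$ to an element of $\{1,\ldots,\lfloor q/2\rfloor\}$. The $A$-polynomial $\mathcal{A}_N(q,y,z)$ is the unique polynomial with $\mathcal{A}_N(q,y,z)=\sum_{f\ q\text{ -coflow}}y^{|f_A^>|}z^{|f_A^<|}$ for all odd positive integers $q$, and $\mathcal{A}_D:=\mathcal{A}_{N_D}$.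 -}

module Defs where

open import Level using (Level)
open import Data.Bool using (Bool; true; false; _∧_; _∨_; if_then_else_)
open import Data.Nat as ℕ using (ℕ; zero; suc; NonZero; _/_)
open import Data.Fin using (Fin; toℕ)
open import Data.Vec using (Vec; []; _∷_; lookup)
open import Data.List using (List; []; _∷_; map; concatMap; foldr; length; filter; allFin)
open import Data.List.Relation.Unary.Unique.Propositional using (Unique)
open import Data.List.Relation.Unary.All using (All)
open import Data.Integer as ℤ using (ℤ; +_; -_; _-_; _%ℕ_; _≤ᵇ_)
open import Data.Integer.Divisibility using (_∣_)
open import Data.Product using (∃; _×_)
open import Data.Sum using (_⊎_)
open import Relation.Binary.PropositionalEquality using (_≡_)
open import Relation.Binary.Construct.Closure.ReflexiveTransitive using (Star)
open import Algebra.Bundles using (CommutativeRing)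

record Digraph : Set where
  field
    nV   : ℕ
    nA   : ℕ
    orig : Fin nA → Fin nV
    end  : Fin nA → Fin nV

open Digraph public

Adjacent : (D : Digraph) → Fin (nV D) → Fin (nV D) → Set
Adjacent D u v = ∃ λ a → (orig D a ≡ u × end D a ≡ v) ⊎ (orig D a ≡ v × end D a ≡ u)

Connected : (D : Digraph) → Fin (nV D) → Fin (nV D) → Set
Connected D = Star (Adjacent D)

-- Signed circuits of N_D = simple cycles of the underlying graph with a
-- direction of traversal.  A traversal step uses arc `arc`, forwards
-- (fwd = true: from orig to end) or backwards.

record Step (D : Digraph) : Set where
  constructor step
  field
    arc : Fin (nA D)
    fwd : Bool

open Step public

stepFrom : (D : Digraph) → Step D → Fin (nV D)
stepFrom D s = if fwd s then orig D (arc s) else end D (arc s)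

stepTo : (D : Digraph) → Step D → Fin (nV D)
stepTo D s = if fwd s then end D (arc s) else orig D (arc s)

Chain : (D : Digraph) → Step D → List (Step D) → Fin (nV D) → Set
Chain D s []       w = stepTo D s ≡ w
Chain D s (t ∷ ts) w = (stepTo D s ≡ stepFrom D t) × Chain D t ts w

IsSimpleCycle : (D : Digraph) → List (Step D) → Set
IsSimpleCycle D []       = Data.Empty.⊥
  where import Data.Empty
IsSimpleCycle D (s ∷ ss) =
  Chain D s ss (stepFrom D s)
  × Unique (map arc (s ∷ ss))
  × Unique (map (stepFrom D) (s ∷ ss))

-- q-coflows, with Z/qZ represented by Fin q (canonical representatives)

val : ∀ {q} → Fin q → ℤ
val x = + toℕ x

signedSum : (D : Digraph) {q : ℕ} → Vec (Fin q) (nA D) → List (Step D) → ℤ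
signedSum D f []       = + 0
signedSum D f (s ∷ ss) =
  (if fwd s then val (lookup f (arc s)) else - val (lookup f (arc s)))
  ℤ.+ signedSum D f ss

IsCoflow : (D : Digraph) (q : ℕ) → Vec (Fin q) (nA D) → Set
IsCoflow D q f = ∀ (C : List (Step D)) → IsSimpleCycle D C → (+ q) ∣ signedSum D f C

posClass : (q : ℕ) .{{_ : NonZero q}} → ℤ → Bool
posClass q x = (+ 1 ≤ᵇ + (x %ℕ q)) ∧ (+ (x %ℕ q) ≤ᵇ + (q / 2))

countArcs : (D : Digraph) → (Fin (nA D) → Bool) → ℕ
countArcs D p = length (filter (λ a → Relation.Nullary.Decidable.Core.T? (p a)) (allFin (nA D)))
  where import Relation.Nullary.Decidable.Core

fPos : (D : Digraph) (q : ℕ) .{{_ : NonZero q}} → Vec (Fin q) (nA D) → ℕ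
fPos D q f = countArcs D (λ a → posClass q (val (lookup f a)))

fNeg : (D : Digraph) (q : ℕ) .{{_ : NonZero q}} → Vec (Fin q) (nA D) → ℕ
fNeg D q f = countArcs D (λ a → posClass q (- val (lookup f a)))

inS : (q : ℕ) → ℤ → Bool
inS q d = ((+ 1 ≤ᵇ d) ∧ (d ≤ᵇ + (q / 2)))
        ∨ (((- + q) ℤ.+ + 1 ≤ᵇ d) ∧ (d ≤ᵇ (- + q) ℤ.+ + (q / 2)))

allVecs : (k q : ℕ) → List (Vec (Fin q) k)
allVecs zero    q = [] ∷ []
allVecs (suc k) q = concatMap (λ i → map (i ∷_) (allVecs k q)) (allFin q)

-- a map f : V → {1,…,q} is encoded by g : Vec (Fin q) nV with f(v) = 1 + g[v]
label : ∀ {n q} → Vec (Fin q) n → Fin n → ℤ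
label g v = + suc (toℕ (lookup g v))

vPos : (D : Digraph) (q : ℕ) → Vec (Fin q) (nV D) → ℕ
vPos D q g = countArcs D (λ a → inS q (label g (end D a) - label g (orig D a)))

vNeg : (D : Digraph) (q : ℕ) → Vec (Fin q) (nV D) → ℕ
vNeg D q g = countArcs D (λ a → inS q (label g (orig D a) - label g (end D a)))

-- Evaluation of the two sides in an arbitrary commutative ring R
-- (a polynomial identity in ℤ[y,z] ⇔ it holds for all y z in all
-- commutative rings).

module _ {c ℓ : Level} (R : CommutativeRing c ℓ) where
  open CommutativeRing R

  _^ᴿ_ : Carrier → ℕ → Carrier
  x ^ᴿ zero  = 1#
  x ^ᴿ suc n = x * (x ^ᴿ n)

  sumR : List Carrier → Carrier
  sumR = foldr _+_ 0#

  -- Σ_{f ∈ L} y^{|f_A^>|} z^{|f_A^<|}, L an enumeration of the q-coflows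
  coflowSum : (D : Digraph) (q : ℕ) .{{_ : NonZero q}} →
              List (Vec (Fin q) (nA D)) → Carrier → Carrier → Carrier
  coflowSum D q L y z = sumR (map (λ f → (y ^ᴿ fPos D q f) * (z ^ᴿ fNeg D q f)) L)

  vertexSum : (D : Digraph) (q : ℕ) → Carrier → Carrier → Carrier
  vertexSum D q y z =
    sumR (map (λ g → (y ^ᴿ vPos D q g) * (z ^ᴿ vNeg D q g)) (allVecs (nV D) q))

  natMul : ℕ → Carrier → Carrier
  natMul zero    x = 0#
  natMul (suc n) x = x + natMul n x

-- A potential g : V → ℤ/q has the tension δg(a) = g(end a) − g(orig a), and every tension is a
-- q-coflow. Conversely every q-coflow f is a tension: fix a root in each component and integrate f
-- along a walk from the root. This is well defined because f sums to 0 around every closed walk,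
-- which is cut into simple cycles and backtracks by removing loops. Two potentials have the same
-- tension iff they differ by a constant on each component, so every coflow is the tension of exactly
-- q^comp(D) potentials. Finally, reading g as the vertex labelling 1 + g(v) ∈ {1,…,q}, the label
-- difference along an arc lies in S_q iff its tension lies in {1,…,⌊q/2⌋} mod q (for any q ≥ 1),
-- so every potential contributes the monomial of its tension.

module Submission where

open import Defs
open import Level using (0ℓ)
open import Data.Bool using (Bool; T; true; false; not; _∧_; _∨_; if_then_else_)
open import Data.Bool.Properties using (∧-zeroʳ; ∨-identityʳ; T-≡; ⇔→≡)
open import Data.Empty using (⊥-elim)
open import Data.Nat as ℕ using (ℕ; zero; suc; NonZero; _*_; _^_; _/_; _≤_; _<_; _∸_; z≤n; s≤s)
import Data.Nat.Properties as ℕₚ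
open import Data.Nat.DivMod using (m<n⇒m%n≡m; m/n<m)
import Data.Nat.Divisibility as ℕ∣
open import Data.Fin using (Fin; toℕ; fromℕ<)
open import Data.Fin.Properties using (_≟_; toℕ-fromℕ<; toℕ<n; toℕ-injective)
open import Data.Vec using (Vec; []; _∷_; lookup; tabulate)
open import Data.Vec.Properties
  using (∷-injectiveˡ; ∷-injectiveʳ; lookup∘tabulate; tabulate∘lookup; tabulate-cong)
open import Data.List
  using (List; []; _∷_; _++_; map; length; concatMap; cartesianProductWith; allFin)
open import Data.List.Properties
  using (length-++; length-map; length-tabulate; map-++; map-∘; map-cong; ++-assoc; filter-≐)
open import Data.List.Membership.Propositional using (_∈_; _∉_)
open import Data.List.Membership.Propositional.Properties
  using (∈-map⁺; ∈-map⁻; ∈-++⁺ʳ; ∈-allFin; ∈-cartesianProductWith⁺; ∈-cartesianProductWith⁻)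
open import Data.List.Membership.Propositional.Properties.WithK using (unique∧set⇒bag)
open import Data.List.Relation.Unary.Any using (here; there; any?)
open import Data.List.Relation.Unary.All as All using ([]; _∷_)
import Data.List.Relation.Unary.All.Properties as Allₚ
open import Data.List.Relation.Unary.AllPairs using ([]; _∷_)
open import Data.List.Relation.Unary.Unique.Propositional using (Unique)
open import Data.List.Relation.Unary.Unique.Propositional.Properties
  using (++⁺; cartesianProductWith⁺; allFin⁺)
open import Data.List.Relation.Binary.Disjoint.Propositional using (Disjoint)
open import Data.List.Relation.Binary.Permutation.Propositional using (_↭_; ↭⇒↭ₛ′)
import Data.List.Relation.Binary.Permutation.Propositional.Properties as ↭
import Data.List.Relation.Binary.Permutation.Setoid.Properties as ↭ₛ
open import Data.List.Relation.Binary.BagAndSetEquality using (∼bag⇒↭)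
open import Data.Integer as ℤ using (ℤ; +_; -[1+_]; -_; _-_; _%ℕ_; _/ℕ_)
import Data.Integer.Properties as ℤₚ
open import Data.Integer.DivMod using (n%ℕd<d; a≡a%ℕn+[a/ℕn]*n)
import Data.Integer.Divisibility as Unsigned
open import Data.Integer.Divisibility.Signed using (_∣_; divides; ∣m∣n⇒∣m+n; ∣m⇒∣-m; ∣⇒∣ᵤ; ∣ᵤ⇒∣)
open import Data.Integer.Tactic.RingSolver using (solve-∀)
open import Data.Product as Product using (Σ; ∃; ∃₂; _×_; _,_; proj₁; proj₂)
open import Data.Sum using (_⊎_; inj₁; inj₂)
open import Function.Bundles using (_⇔_; mk⇔; Equivalence)
open import Relation.Nullary using (yes; no)
open import Relation.Nullary.Decidable.Core using (T?)
open import Relation.Binary.Bundles using (Setoid)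
open import Relation.Binary.Construct.Closure.ReflexiveTransitive using (ε; _◅_)
open import Relation.Binary.PropositionalEquality
  using (_≡_; refl; sym; trans; cong; cong₂; subst; module ≡-Reasoning)
open import Algebra.Bundles using (CommutativeRing)

module _ {a b} {A : Set a} {B : Set b} where

  Unique-map⁺-on : ∀ (f : A → B) {xs} → (∀ {x y} → x ∈ xs → y ∈ xs → f x ≡ f y → x ≡ y) →
                   Unique xs → Unique (map f xs)
  Unique-map⁺-on f inj [] = []
  Unique-map⁺-on f inj (x∉xs ∷ xs!) =
    Allₚ.map⁺ (All.tabulate λ y∈xs fx≡fy → All.lookup x∉xs y∈xs (inj (here refl) (there y∈xs) fx≡fy))
    ∷ Unique-map⁺-on f (λ x∈ y∈ → inj (there x∈) (there y∈)) xs!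

module _ {a} {A : Set a} where

  Unique-++⁻ : ∀ (xs : List A) {ys} → Unique (xs ++ ys) → Unique xs × Unique ys × Disjoint xs ys
  Unique-++⁻ []       ys!          = [] , ys! , λ ()
  Unique-++⁻ (x ∷ xs) (x∉ ∷ xsys!) with Unique-++⁻ xs xsys!
  ... | xs! , ys! , xs#ys = Allₚ.++⁻ˡ xs x∉ ∷ xs! , ys! , λ where
    (here refl , x∈ys)   → All.lookup (Allₚ.++⁻ʳ xs x∉) x∈ys refl
    (there v∈xs , v∈ys) → xs#ys (v∈xs , v∈ys)

module _ {a b c} {A : Set a} {B : Set b} {C : Set c} where

  concatMap-map≡cartesianProductWith : ∀ (f : A → B → C) xs ys →
    concatMap (λ x → map (f x) ys) xs ≡ cartesianProductWith f xs ys
  concatMap-map≡cartesianProductWith f []       ys = refl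
  concatMap-map≡cartesianProductWith f (x ∷ xs) ys =
    cong (map (f x) ys ++_) (concatMap-map≡cartesianProductWith f xs ys)

  length-cartesianProductWith : ∀ (f : A → B → C) xs ys →
    length (cartesianProductWith f xs ys) ≡ length xs * length ys
  length-cartesianProductWith f []       ys = refl
  length-cartesianProductWith f (x ∷ xs) ys = begin
    length (map (f x) ys ++ cartesianProductWith f xs ys)
      ≡⟨ length-++ (map (f x) ys) ⟩
    length (map (f x) ys) ℕ.+ length (cartesianProductWith f xs ys)
      ≡⟨ cong₂ ℕ._+_ (length-map (f x) ys) (length-cartesianProductWith f xs ys) ⟩
    length ys ℕ.+ length xs * length ys
      ∎
    where open ≡-Reasoning

  Unique-cartesianProductWith⁺-on : ∀ (f : A → B → C) {xs ys} →
    (∀ {w x y z} → w ∈ xs → x ∈ xs → y ∈ ys → z ∈ ys → f w y ≡ f x z → w ≡ x × y ≡ z) →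
    Unique xs → Unique ys → Unique (cartesianProductWith f xs ys)
  Unique-cartesianProductWith⁺-on f inj [] ys! = []
  Unique-cartesianProductWith⁺-on f {x ∷ xs} {ys} inj (x∉xs ∷ xs!) ys! =
    ++⁺ (Unique-map⁺-on (f x) (λ y∈ z∈ e → proj₂ (inj (here refl) (here refl) y∈ z∈ e)) ys!)
        (Unique-cartesianProductWith⁺-on f (λ w∈ x∈ → inj (there w∈) (there x∈)) xs! ys!)
        fibres-disjoint
    where
    fibres-disjoint : Disjoint (map (f x) ys) (cartesianProductWith f xs ys)
    fibres-disjoint (v∈fibre , v∈rest)
      with y , y∈ys , refl ← ∈-map⁻ (f x) v∈fibre
      with w , z , w∈xs , z∈ys , e ← ∈-cartesianProductWith⁻ f xs ys v∈rest
      = All.lookup x∉xs w∈xs (proj₁ (inj (here refl) (there w∈xs) y∈ys z∈ys e))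

module _ (q : ℕ) where

  allVecs-suc : ∀ n → allVecs (suc n) q ≡ cartesianProductWith _∷_ (allFin q) (allVecs n q)
  allVecs-suc n = concatMap-map≡cartesianProductWith _∷_ (allFin q) (allVecs n q)

  ∈-allVecs : ∀ {n} (v : Vec (Fin q) n) → v ∈ allVecs n q
  ∈-allVecs []            = here refl
  ∈-allVecs {suc n} (i ∷ v) =
    subst (_ ∈_) (sym (allVecs-suc n)) (∈-cartesianProductWith⁺ _∷_ (∈-allFin i) (∈-allVecs v))

  allVecs-unique : ∀ n → Unique (allVecs n q)
  allVecs-unique zero    = [] ∷ []
  allVecs-unique (suc n) = subst Unique (sym (allVecs-suc n))
    (cartesianProductWith⁺ _∷_ (λ e → ∷-injectiveˡ e , ∷-injectiveʳ e) (allFin⁺ q) (allVecs-unique n))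

  length-allVecs : ∀ n → length (allVecs n q) ≡ q ^ n
  length-allVecs zero    = refl
  length-allVecs (suc n) = begin
    length (allVecs (suc n) q)
      ≡⟨ cong length (allVecs-suc n) ⟩
    length (cartesianProductWith _∷_ (allFin q) (allVecs n q))
      ≡⟨ length-cartesianProductWith _∷_ (allFin q) _ ⟩
    length (allFin q) * length (allVecs n q)
      ≡⟨ cong₂ _*_ (length-tabulate {n = q} (λ i → i)) (length-allVecs n) ⟩
    q * q ^ n
      ∎
    where open ≡-Reasoning

lookup-extensionality : ∀ {a} {A : Set a} {m} {xs ys : Vec A m} → (∀ i → lookup xs i ≡ lookup ys i) → xs ≡ ys
lookup-extensionality {xs = xs} {ys} xs≗ys =
  trans (sym (tabulate∘lookup xs)) (trans (tabulate-cong xs≗ys) (tabulate∘lookup ys))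

module Sums {c ℓ} (R : CommutativeRing c ℓ) where
  open CommutativeRing R renaming (refl to ≈-refl; sym to ≈-sym; trans to ≈-trans)
  open import Algebra.Properties.CommutativeSemigroup +-commutativeSemigroup using (interchange)
  open import Relation.Binary.Reasoning.Setoid setoid

  natMul-zeroʳ : ∀ n → natMul R n 0# ≈ 0#
  natMul-zeroʳ zero    = ≈-refl
  natMul-zeroʳ (suc n) = ≈-trans (+-identityˡ _) (natMul-zeroʳ n)

  natMul-distribˡ-+ : ∀ n x y → natMul R n (x + y) ≈ natMul R n x + natMul R n y
  natMul-distribˡ-+ zero    x y = ≈-sym (+-identityˡ 0#)
  natMul-distribˡ-+ (suc n) x y = ≈-trans (+-congˡ (natMul-distribˡ-+ n x y)) (interchange x y _ _)

  ∑ : ∀ {a} {A : Set a} → List A → (A → Carrier) → Carrier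
  ∑ xs F = sumR R (map F xs)

  module _ {a} {A : Set a} where

    ∑-++ : ∀ (F : A → Carrier) xs ys → ∑ (xs ++ ys) F ≈ ∑ xs F + ∑ ys F
    ∑-++ F []       ys = ≈-sym (+-identityˡ _)
    ∑-++ F (x ∷ xs) ys = ≈-trans (+-congˡ (∑-++ F xs ys)) (≈-sym (+-assoc _ _ _))

    ∑-cong : ∀ {F G : A → Carrier} xs → (∀ {x} → x ∈ xs → F x ≈ G x) → ∑ xs F ≈ ∑ xs G
    ∑-cong []       F≈G = ≈-refl
    ∑-cong (x ∷ xs) F≈G = +-cong (F≈G (here refl)) (∑-cong xs (λ x∈ → F≈G (there x∈)))

    ∑-const : ∀ (xs : List A) x → ∑ xs (λ _ → x) ≡ natMul R (length xs) x
    ∑-const []       x = refl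
    ∑-const (_ ∷ xs) x = cong (λ t → x + t) (∑-const xs x)

    ∑-natMul : ∀ n (F : A → Carrier) xs → ∑ xs (λ x → natMul R n (F x)) ≈ natMul R n (∑ xs F)
    ∑-natMul n F []       = ≈-sym (natMul-zeroʳ n)
    ∑-natMul n F (x ∷ xs) = ≈-trans (+-congˡ (∑-natMul n F xs)) (≈-sym (natMul-distribˡ-+ n _ _))

    ∑-↭ : ∀ (F : A → Carrier) {xs ys} → xs ↭ ys → ∑ xs F ≈ ∑ ys F
    ∑-↭ F p = ↭ₛ.foldr-commMonoid setoid +-isCommutativeMonoid (↭⇒↭ₛ′ isEquivalence (↭.map⁺ F p))

  module _ {a b d} {A : Set a} {B : Set b} {C : Set d} where

    ∑-cartesianProductWith : ∀ (F : C → Carrier) (g : A → B → C) xs ys →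
      ∑ (cartesianProductWith g xs ys) F ≈ ∑ xs (λ x → ∑ ys (λ y → F (g x y)))
    ∑-cartesianProductWith F g []       ys = ≈-refl
    ∑-cartesianProductWith F g (x ∷ xs) ys = begin
      ∑ (map (g x) ys ++ cartesianProductWith g xs ys) F
        ≈⟨ ∑-++ F (map (g x) ys) _ ⟩
      ∑ (map (g x) ys) F + ∑ (cartesianProductWith g xs ys) F
        ≡⟨ cong (_+ _) (cong (sumR R) (map-∘ ys)) ⟨
      ∑ ys (λ y → F (g x y)) + ∑ (cartesianProductWith g xs ys) F
        ≈⟨ +-congˡ (∑-cartesianProductWith F g xs ys) ⟩
      ∑ ys (λ y → F (g x y)) + ∑ xs (λ x → ∑ ys (λ y → F (g x y)))
        ∎

    ∑-uniformFibres : ∀ (F : C → Carrier) (w : A → Carrier) (g : A → B → C) {xs ys zs} →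
      cartesianProductWith g xs ys ↭ zs → (∀ {x} y → x ∈ xs → F (g x y) ≈ w x) →
      ∑ zs F ≈ natMul R (length ys) (∑ xs w)
    ∑-uniformFibres F w g {xs} {ys} {zs} fibres↭zs Fg≈w = begin
      ∑ zs F                                  ≈⟨ ∑-↭ F fibres↭zs ⟨
      ∑ (cartesianProductWith g xs ys) F      ≈⟨ ∑-cartesianProductWith F g xs ys ⟩
      ∑ xs (λ x → ∑ ys (λ y → F (g x y)))     ≈⟨ ∑-cong xs (λ x∈ → ∑-cong ys (λ {y} _ → Fg≈w y x∈)) ⟩
      ∑ xs (λ x → ∑ ys (λ _ → w x))           ≡⟨ cong (sumR R) (map-cong (λ x → ∑-const ys (w x)) xs) ⟩
      ∑ xs (λ x → natMul R (length ys) (w x)) ≈⟨ ∑-natMul (length ys) w xs ⟩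
      natMul R (length ys) (∑ xs w)           ∎

∣+m-+n∣<q : ∀ {q m n} → m < q → n < q → ℤ.∣ + m - + n ∣ < q
∣+m-+n∣<q {m = m} {n} m<q n<q rewrite ℤₚ.[+m]-[+n]≡m⊖n m n =
  ℕₚ.≤-<-trans (ℤₚ.∣m⊝n∣≤m⊔n m n) (ℕₚ.⊔-pres-<m m<q n<q)

-[i-j]≡j-i : ∀ i j → - (i - j) ≡ j - i
-[i-j]≡j-i = solve-∀

m∸n≤o⇒m∸o≤n : ∀ m n o → m ∸ n ≤ o → m ∸ o ≤ n
m∸n≤o⇒m∸o≤n m n o m∸n≤o = ℕₚ.m≤n+o⇒m∸n≤o m o (begin
  m           ≤⟨ ℕₚ.m≤n+m∸n m n ⟩
  n ℕ.+ (m ∸ n) ≤⟨ ℕₚ.+-monoʳ-≤ n m∸n≤o ⟩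
  n ℕ.+ o     ≡⟨ ℕₚ.+-comm n o ⟩
  o ℕ.+ n     ∎)
  where open ℕₚ.≤-Reasoning

≤ᵇ≡≤ᵇ : ∀ {m n o p} → (m ≤ n → o ≤ p) → (o ≤ p → m ≤ n) → (m ℕ.≤ᵇ n) ≡ (o ℕ.≤ᵇ p)
≤ᵇ≡≤ᵇ {m} {n} {o} {p} to from = ⇔→≡ {z = true} (mk⇔
  (λ e → Equivalence.to T-≡ (ℕₚ.≤⇒≤ᵇ (to (ℕₚ.≤ᵇ⇒≤ m n (Equivalence.from T-≡ e)))))
  (λ e → Equivalence.to T-≡ (ℕₚ.≤⇒≤ᵇ (from (ℕₚ.≤ᵇ⇒≤ o p (Equivalence.from T-≡ e))))))

≤⇒≤ᵇ≡true : ∀ {m n} → m ≤ n → (m ℕ.≤ᵇ n) ≡ true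
≤⇒≤ᵇ≡true m≤n = Equivalence.to T-≡ (ℕₚ.≤⇒≤ᵇ m≤n)

-[1+j]%ℕq≡q∸[1+j] : ∀ q .{{_ : NonZero q}} j → suc j < q → -[1+ j ] %ℕ q ≡ q ∸ suc j
-[1+j]%ℕq≡q∸[1+j] q j 1+j<q with suc j ℕ.% q | m<n⇒m%n≡m 1+j<q
... | .(suc j) | refl = refl

module _ (n : ℕ) where

  private
    h : ℕ
    h = suc n / 2

    h≤n : h ≤ n
    h≤n = ℕ.s≤s⁻¹ (m/n<m (suc n) 2 (s≤s (s≤s z≤n)))

    -[1+n]+h≡-[1+n∸h] : -[1+ n ] ℤ.+ + h ≡ -[1+ n ∸ h ]
    -[1+n]+h≡-[1+n∸h] = trans (ℤₚ.⊖-< (s≤s h≤n)) (cong (λ m → - + m) (ℕₚ.+-∸-assoc 1 h≤n))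

  posClass≡inS : ∀ d → ℤ.∣ d ∣ < suc n → posClass (suc n) d ≡ inS (suc n) d
  posClass≡inS (+ j) j<q = begin
    (1 ℕ.≤ᵇ j ℕ.% suc n) ∧ (j ℕ.% suc n ℕ.≤ᵇ h)
      ≡⟨ cong (λ r → (1 ℕ.≤ᵇ r) ∧ (r ℕ.≤ᵇ h)) (m<n⇒m%n≡m j<q) ⟩
    (1 ℕ.≤ᵇ j) ∧ (j ℕ.≤ᵇ h)
      ≡⟨ ∨-identityʳ ((1 ℕ.≤ᵇ j) ∧ (j ℕ.≤ᵇ h)) ⟨
    ((1 ℕ.≤ᵇ j) ∧ (j ℕ.≤ᵇ h)) ∨ false
      ≡⟨ cong (((1 ℕ.≤ᵇ j) ∧ (j ℕ.≤ᵇ h)) ∨_) (∧-zeroʳ (-[1+ n ] ℤ.+ + 1 ℤ.≤ᵇ + j)) ⟨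
    ((1 ℕ.≤ᵇ j) ∧ (j ℕ.≤ᵇ h)) ∨ ((-[1+ n ] ℤ.+ + 1 ℤ.≤ᵇ + j) ∧ (+ j ℤ.≤ᵇ -[1+ n ∸ h ]))
      ≡⟨ cong (λ t → ((1 ℕ.≤ᵇ j) ∧ (j ℕ.≤ᵇ h)) ∨ ((-[1+ n ] ℤ.+ + 1 ℤ.≤ᵇ + j) ∧ (+ j ℤ.≤ᵇ t)))
              -[1+n]+h≡-[1+n∸h] ⟨
    inS (suc n) (+ j)
      ∎
    where open ≡-Reasoning
  posClass≡inS -[1+ j ] (s≤s j<n@(s≤s {n = m} j≤m)) = begin
    posClass (suc n) -[1+ j ]
      ≡⟨ cong (λ r → (1 ℕ.≤ᵇ r) ∧ (r ℕ.≤ᵇ h)) (-[1+j]%ℕq≡q∸[1+j] (suc n) j (s≤s j<n)) ⟩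
    (1 ℕ.≤ᵇ n ∸ j) ∧ (n ∸ j ℕ.≤ᵇ h)
      ≡⟨ cong (_∧ (n ∸ j ℕ.≤ᵇ h)) (≤⇒≤ᵇ≡true (ℕₚ.m<n⇒0<n∸m j<n)) ⟩
    n ∸ j ℕ.≤ᵇ h
      ≡⟨ ≤ᵇ≡≤ᵇ (m∸n≤o⇒m∸o≤n n j h) (m∸n≤o⇒m∸o≤n n h j) ⟩
    n ∸ h ℕ.≤ᵇ j
      ≡⟨ cong (_∧ (n ∸ h ℕ.≤ᵇ j)) (≤⇒≤ᵇ≡true j≤m) ⟨
    (j ℕ.≤ᵇ m) ∧ (n ∸ h ℕ.≤ᵇ j)
      ≡⟨ cong (λ t → (j ℕ.≤ᵇ m) ∧ (-[1+ j ] ℤ.≤ᵇ t)) -[1+n]+h≡-[1+n∸h] ⟨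
    inS (suc n) -[1+ j ]
      ∎
    where open ≡-Reasoning

module Congruence (q : ℕ) where

  infix 4 _≋_
  record _≋_ (x y : ℤ) : Set where
    constructor mk≋
    field q∣x-y : + q ∣ x - y

  private
    q∣-resp : ∀ {a b} → a ≡ b → + q ∣ a → + q ∣ b
    q∣-resp = subst (+ q ∣_)

  ≡⇒≋ : ∀ {x y} → x ≡ y → x ≋ y
  ≡⇒≋ {x} refl = mk≋ (divides (+ 0) (ℤₚ.+-inverseʳ x))

  ≋-refl : ∀ {x} → x ≋ x
  ≋-refl = ≡⇒≋ refl

  ≋-sym : ∀ {x y} → x ≋ y → y ≋ x
  ≋-sym {x} {y} (mk≋ q∣x-y) = mk≋ (q∣-resp (-[i-j]≡j-i x y) (∣m⇒∣-m q∣x-y))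

  ≋-trans : ∀ {x y z} → x ≋ y → y ≋ z → x ≋ z
  ≋-trans {x} {y} {z} (mk≋ q∣x-y) (mk≋ q∣y-z) =
    mk≋ (q∣-resp (lemma x y z) (∣m∣n⇒∣m+n q∣x-y q∣y-z))
    where lemma : ∀ x y z → (x - y) ℤ.+ (y - z) ≡ x - z
          lemma = solve-∀

  ≋-+-cong : ∀ {x x′ y y′} → x ≋ x′ → y ≋ y′ → x ℤ.+ y ≋ x′ ℤ.+ y′
  ≋-+-cong {x} {x′} {y} {y′} (mk≋ q∣x-x′) (mk≋ q∣y-y′) =
    mk≋ (q∣-resp (lemma x x′ y y′) (∣m∣n⇒∣m+n q∣x-x′ q∣y-y′))
    where lemma : ∀ x x′ y y′ → (x - x′) ℤ.+ (y - y′) ≡ (x ℤ.+ y) - (x′ ℤ.+ y′)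
          lemma = solve-∀

  ≋-neg-cong : ∀ {x y} → x ≋ y → - x ≋ - y
  ≋-neg-cong {x} {y} (mk≋ q∣x-y) = mk≋ (q∣-resp (lemma x y) (∣m⇒∣-m q∣x-y))
    where lemma : ∀ x y → - (x - y) ≡ (- x) - (- y)
          lemma = solve-∀

  ≋-+-cancelˡ : ∀ z {x y} → z ℤ.+ x ≋ z ℤ.+ y → x ≋ y
  ≋-+-cancelˡ z {x} {y} (mk≋ q∣diff) = mk≋ (q∣-resp (lemma x y z) q∣diff)
    where lemma : ∀ x y z → (z ℤ.+ x) - (z ℤ.+ y) ≡ x - y
          lemma = solve-∀

  ≋-setoid : Setoid 0ℓ 0ℓ
  ≋-setoid = record
    { Carrier       = ℤ
    ; _≈_           = _≋_
    ; isEquivalence = record { refl = ≋-refl ; sym = ≋-sym ; trans = ≋-trans }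
    }

  ≋0⇒∣ : ∀ {x} → x ≋ + 0 → + q Unsigned.∣ x
  ≋0⇒∣ {x} (mk≋ q∣x-0) = ∣⇒∣ᵤ (q∣-resp (ℤₚ.+-identityʳ x) q∣x-0)

  ∣⇒≋0 : ∀ {x} → + q Unsigned.∣ x → x ≋ + 0
  ∣⇒≋0 {x} q∣x = mk≋ (q∣-resp (sym (ℤₚ.+-identityʳ x)) (∣ᵤ⇒∣ q∣x))

  module _ .{{_ : NonZero q}} where

    residue : ℤ → Fin q
    residue x = fromℕ< (n%ℕd<d x q)

    toℕ-residue : ∀ x → toℕ (residue x) ≡ x %ℕ q
    toℕ-residue x = toℕ-fromℕ< (n%ℕd<d x q)

    val-residue : ∀ x → val (residue x) ≋ x
    val-residue x = mk≋ (divides (- (x /ℕ q)) (begin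
      val (residue x) - x
        ≡⟨ cong (λ r → + r - x) (toℕ-residue x) ⟩
      + (x %ℕ q) - x
        ≡⟨ cong (λ t → + (x %ℕ q) - t) (a≡a%ℕn+[a/ℕn]*n x q) ⟩
      + (x %ℕ q) - (+ (x %ℕ q) ℤ.+ (x /ℕ q) ℤ.* + q)
        ≡⟨ lemma (+ (x %ℕ q)) (x /ℕ q) (+ q) ⟩
      - (x /ℕ q) ℤ.* + q
        ∎))
      where
      open ≡-Reasoning
      lemma : ∀ r d q → r - (r ℤ.+ d ℤ.* q) ≡ - d ℤ.* q
      lemma = solve-∀

    val-injective : ∀ {a b : Fin q} → val a ≋ val b → a ≡ b
    val-injective {a} {b} (mk≋ q∣a-b) =
      toℕ-injective (ℤₚ.+-injective (ℤₚ.i-j≡0⇒i≡j _ _ (ℤₚ.∣i∣≡0⇒i≡0 (begin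
        ℤ.∣ val a - val b ∣           ≡⟨ m<n⇒m%n≡m (∣+m-+n∣<q (toℕ<n a) (toℕ<n b)) ⟨
        ℤ.∣ val a - val b ∣ ℕ.% q     ≡⟨ ℕ∣.n∣m⇒m%n≡0 _ q (∣⇒∣ᵤ q∣a-b) ⟩
        0                             ∎))))
      where open ≡-Reasoning

    residue-cong : ∀ {x y} → x ≋ y → residue x ≡ residue y
    residue-cong {x} {y} x≋y = val-injective (≋-trans (val-residue x) (≋-trans x≋y (≋-sym (val-residue y))))

    residue-val : ∀ (a : Fin q) → residue (val a) ≡ a
    residue-val a = val-injective (val-residue (val a))

    %ℕ-cong : ∀ {x y} → x ≋ y → x %ℕ q ≡ y %ℕ q
    %ℕ-cong {x} {y} x≋y = trans (sym (toℕ-residue x)) (trans (cong toℕ (residue-cong x≋y)) (toℕ-residue y))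

    posClass-cong : ∀ {x y} → x ≋ y → posClass q x ≡ posClass q y
    posClass-cong x≋y = cong (λ r → (+ 1 ℤ.≤ᵇ + r) ∧ (+ r ℤ.≤ᵇ + (q / 2))) (%ℕ-cong x≋y)

module Walks (D : Digraph) where

  Vertex : Set
  Vertex = Fin (nV D)

  Walk : Vertex → List (Step D) → Vertex → Set
  Walk u []       w = u ≡ w
  Walk u (s ∷ ss) w = stepFrom D s ≡ u × Walk (stepTo D s) ss w

  walk-++ : ∀ {x y z} ss {ts} → Walk x ss y → Walk y ts z → Walk x (ss ++ ts) z
  walk-++ []       refl              ts-walk = ts-walk
  walk-++ (s ∷ ss) (refl , ss-walk) ts-walk = refl , walk-++ ss ss-walk ts-walk

  reverseStep : Step D → Step D
  reverseStep (step a forwards) = step a (not forwards)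

  stepFrom-reverseStep : ∀ s → stepFrom D (reverseStep s) ≡ stepTo D s
  stepFrom-reverseStep (step a true)  = refl
  stepFrom-reverseStep (step a false) = refl

  stepTo-reverseStep : ∀ s → stepTo D (reverseStep s) ≡ stepFrom D s
  stepTo-reverseStep (step a true)  = refl
  stepTo-reverseStep (step a false) = refl

  sameArc : ∀ s t → arc s ≡ arc t → t ≡ s ⊎ t ≡ reverseStep s
  sameArc (step a true)  (step .a true)  refl = inj₁ refl
  sameArc (step a true)  (step .a false) refl = inj₂ refl
  sameArc (step a false) (step .a true)  refl = inj₂ refl
  sameArc (step a false) (step .a false) refl = inj₁ refl

  reverseWalk : List (Step D) → List (Step D)
  reverseWalk []       = []
  reverseWalk (s ∷ ss) = reverseWalk ss ++ reverseStep s ∷ []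

  walk-reverse : ∀ {x y} ss → Walk x ss y → Walk y (reverseWalk ss) x
  walk-reverse []       refl           = refl
  walk-reverse (s ∷ ss) (refl , walk) =
    walk-++ (reverseWalk ss) (walk-reverse ss walk) (stepFrom-reverseStep s , stepTo-reverseStep s)

  chain⇒walk : ∀ s ss {w} → Chain D s ss w → Walk (stepTo D s) ss w
  chain⇒walk s []       eq          = eq
  chain⇒walk s (t ∷ ts) (eq , chain) = sym eq , chain⇒walk t ts chain

  walk⇒chain : ∀ s ss {w} → Walk (stepTo D s) ss w → Chain D s ss w
  walk⇒chain s []       eq           = eq
  walk⇒chain s (t ∷ ts) (eq , walk) = sym eq , walk⇒chain t ts walk

  connected⇒walk : ∀ {u v} → Connected D u v → ∃ λ ss → Walk u ss v
  connected⇒walk ε = [] , refl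
  connected⇒walk ((a , inj₁ (refl , refl)) ◅ path) =
    Product.map (step a true ∷_) (refl ,_) (connected⇒walk path)
  connected⇒walk ((a , inj₂ (refl , refl)) ◅ path) =
    Product.map (step a false ∷_) (refl ,_) (connected⇒walk path)

  starts : List (Step D) → List Vertex
  starts = map (stepFrom D)

  vertices : List (Step D) → Vertex → List Vertex
  vertices ss w = starts ss ++ w ∷ []

  vertices-++ : ∀ ss ts w → vertices (ss ++ ts) w ≡ starts ss ++ vertices ts w
  vertices-++ ss ts w = trans (cong (_++ w ∷ []) (map-++ (stepFrom D) ss ts)) (++-assoc (starts ss) (starts ts) _)

  start∈vertices : ∀ {u w} ss → Walk u ss w → u ∈ vertices ss w
  start∈vertices []       refl     = here refl
  start∈vertices (s ∷ ss) (refl , _) = here refl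

  endpoints∈vertices : ∀ {u w t} ss → Walk u ss w → t ∈ ss →
                       stepFrom D t ∈ vertices ss w × stepTo D t ∈ vertices ss w
  endpoints∈vertices (s ∷ ss) (refl , walk) (here refl) = here refl , there (start∈vertices ss walk)
  endpoints∈vertices (s ∷ ss) (refl , walk) (there t∈ss) =
    Product.map there there (endpoints∈vertices ss walk t∈ss)

  splitAt : ∀ {u v w} ss → Walk u ss w → v ∈ vertices ss w →
            ∃₂ λ ss₁ ss₂ → ss ≡ ss₁ ++ ss₂ × Walk u ss₁ v × Walk v ss₂ w
  splitAt []       refl          (here refl) = [] , [] , refl , refl , refl
  splitAt (s ∷ ss) (refl , walk) (here refl) = [] , s ∷ ss , refl , refl , (refl , walk)
  splitAt (s ∷ ss) (refl , walk) (there v∈)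
    with ss₁ , ss₂ , refl , walk₁ , walk₂ ← splitAt ss walk v∈ =
    s ∷ ss₁ , ss₂ , refl , (refl , walk₁) , walk₂

  closedWalk-unique⇒[] : ∀ {u} ss → Walk u ss u → Unique (vertices ss u) → ss ≡ []
  closedWalk-unique⇒[] []       _          _          = refl
  closedWalk-unique⇒[] (s ∷ ss) (refl , _) (s∉ ∷ _) =
    ⊥-elim (All.lookup s∉ (∈-++⁺ʳ (starts ss) (here refl)) refl)

  freshStart⇒freshArc : ∀ {w} s ss → Walk (stepTo D s) ss w → stepFrom D s ∉ vertices ss w → arc s ∉ map arc ss
  freshStart⇒freshArc s ss walk s∉ arc∈ with ∈-map⁻ arc arc∈
  ... | t , t∈ss , arc-s≡arc-t with sameArc s t arc-s≡arc-t
  ... | inj₁ refl = s∉ (proj₁ (endpoints∈vertices ss walk t∈ss))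
  ... | inj₂ refl = s∉ (subst (_∈ _) (stepTo-reverseStep s) (proj₂ (endpoints∈vertices ss walk t∈ss)))

  reusedArc⇒backtrack : ∀ s ss → Walk (stepTo D s) ss (stepFrom D s) → Unique (starts (s ∷ ss)) →
                        arc s ∈ map arc ss → ss ≡ reverseStep s ∷ []
  reusedArc⇒backtrack s (u ∷ ss) (u-from , walk) (s∉ ∷ u∉ ∷ _) arc∈
    with ∈-map⁻ arc arc∈
  ... | t , t∈ , arc-s≡arc-t with sameArc s t arc-s≡arc-t | t∈
  ... | inj₁ refl | _ = ⊥-elim (All.lookup s∉ (∈-map⁺ (stepFrom D) t∈) refl)
  ... | inj₂ refl | there t∈ss =
    ⊥-elim (All.lookup u∉ (∈-map⁺ (stepFrom D) t∈ss) (trans u-from (sym (stepFrom-reverseStep s))))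
  ... | inj₂ refl | here refl with ss | walk
  ...   | []    | _ = refl
  ...   | v ∷ _ | v-from , _ =
    ⊥-elim (All.lookup s∉ (there (here refl)) (sym (trans v-from (stepTo-reverseStep s))))

  module _ {q : ℕ} (f : Vec (Fin q) (nA D)) where

    stepValue : Step D → ℤ
    stepValue s = if fwd s then val (lookup f (arc s)) else - val (lookup f (arc s))

    signedSum-++ : ∀ ss ts → signedSum D f (ss ++ ts) ≡ signedSum D f ss ℤ.+ signedSum D f ts
    signedSum-++ []       ts = sym (ℤₚ.+-identityˡ _)
    signedSum-++ (s ∷ ss) ts =
      trans (cong (λ t → stepValue s ℤ.+ t) (signedSum-++ ss ts)) (sym (ℤₚ.+-assoc (stepValue s) _ _))

    stepValue-reverseStep : ∀ s → stepValue (reverseStep s) ≡ - stepValue s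
    stepValue-reverseStep (step a true)  = refl
    stepValue-reverseStep (step a false) = sym (ℤₚ.neg-involutive _)

    signedSum-reverseWalk : ∀ ss → signedSum D f (reverseWalk ss) ≡ - signedSum D f ss
    signedSum-reverseWalk []       = refl
    signedSum-reverseWalk (s ∷ ss) = begin
      signedSum D f (reverseWalk ss ++ reverseStep s ∷ [])
        ≡⟨ signedSum-++ (reverseWalk ss) (reverseStep s ∷ []) ⟩
      signedSum D f (reverseWalk ss) ℤ.+ (stepValue (reverseStep s) ℤ.+ + 0)
        ≡⟨ cong₂ (λ x y → x ℤ.+ (y ℤ.+ + 0)) (signedSum-reverseWalk ss) (stepValue-reverseStep s) ⟩
      - signedSum D f ss ℤ.+ (- stepValue s ℤ.+ + 0)
        ≡⟨ lemma (stepValue s) (signedSum D f ss) ⟩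
      - (stepValue s ℤ.+ signedSum D f ss)
        ∎
      where
      open ≡-Reasoning
      lemma : ∀ x y → - y ℤ.+ (- x ℤ.+ + 0) ≡ - (x ℤ.+ y)
      lemma = solve-∀

    signedSum-backtrack : ∀ s → signedSum D f (s ∷ reverseStep s ∷ []) ≡ + 0
    signedSum-backtrack s =
      trans (cong (λ y → stepValue s ℤ.+ (y ℤ.+ + 0)) (stepValue-reverseStep s)) (lemma (stepValue s))
      where lemma : ∀ x → x ℤ.+ (- x ℤ.+ + 0) ≡ + 0
            lemma = solve-∀

module ClosedWalks (D : Digraph) {q : ℕ} (f : Vec (Fin q) (nA D)) where
  open Walks D
  open Congruence q

  record SimpleWalk (u w : Vertex) : Set where
    field
      steps           : List (Step D)
      walk            : Walk u steps w
      vertices-unique : Unique (vertices steps w)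
      arcs-unique     : Unique (map arc steps)
  open SimpleWalk

  module _ (cycles≋0 : ∀ C → IsSimpleCycle D C → signedSum D f C ≋ + 0) where

    -- A closed walk through distinct vertices is a simple cycle unless it reuses an arc, and then
    -- it is a backtrack s, s⁻¹.
    returningWalk≋0 : ∀ s ss → Walk (stepTo D s) ss (stepFrom D s) →
                      Unique (starts (s ∷ ss)) → Unique (map arc ss) → signedSum D f (s ∷ ss) ≋ + 0
    returningWalk≋0 s ss walk starts! arcs! with any? (arc s ≟_) (map arc ss)
    ... | no arc∉ = cycles≋0 (s ∷ ss) (walk⇒chain s ss walk , Allₚ.¬Any⇒All¬ _ arc∉ ∷ arcs! , starts!)
    ... | yes arc∈ =
      subst (λ ts → signedSum D f (s ∷ ts) ≋ + 0) (sym (reusedArc⇒backtrack s ss walk starts! arc∈))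
            (≡⇒≋ (signedSum-backtrack f s))

    removeLoop : ∀ {w} s (p : SimpleWalk (stepTo D s) w) → stepFrom D s ∈ vertices (steps p) w →
                 Σ (SimpleWalk (stepFrom D s) w) λ p′ → signedSum D f (s ∷ steps p) ≋ signedSum D f (steps p′)
    removeLoop {w} s p s∈ with splitAt (steps p) (walk p) s∈
    ... | ss₁ , ss₂ , refl , walk₁ , walk₂
      with starts₁! , vertices₂! , starts₁#vertices₂ ←
             Unique-++⁻ (starts ss₁) (subst Unique (vertices-++ ss₁ ss₂ w) (vertices-unique p))
         | arcs₁! , arcs₂! , _ ←
             Unique-++⁻ (map arc ss₁) (subst Unique (map-++ arc ss₁ ss₂) (arcs-unique p)) =
      record { steps = ss₂ ; walk = walk₂ ; vertices-unique = vertices₂! ; arcs-unique = arcs₂! } ,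
      (begin
        signedSum D f (s ∷ ss₁ ++ ss₂)
          ≡⟨ cong (λ t → stepValue f s ℤ.+ t) (signedSum-++ f ss₁ ss₂) ⟩
        stepValue f s ℤ.+ (signedSum D f ss₁ ℤ.+ signedSum D f ss₂)
          ≡⟨ ℤₚ.+-assoc (stepValue f s) _ _ ⟨
        signedSum D f (s ∷ ss₁) ℤ.+ signedSum D f ss₂
          ≈⟨ ≋-+-cong (returningWalk≋0 s ss₁ walk₁ s∷starts₁! arcs₁!) ≋-refl ⟩
        + 0 ℤ.+ signedSum D f ss₂
          ≡⟨ ℤₚ.+-identityˡ _ ⟩
        signedSum D f ss₂
          ∎)
      where
      open import Relation.Binary.Reasoning.Setoid ≋-setoid
      s∉starts₁ : stepFrom D s ∉ starts ss₁
      s∉starts₁ s∈starts₁ = starts₁#vertices₂ (s∈starts₁ , start∈vertices ss₂ walk₂)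
      s∷starts₁! : Unique (starts (s ∷ ss₁))
      s∷starts₁! = Allₚ.¬Any⇒All¬ _ s∉starts₁ ∷ starts₁!

    shortcut : ∀ {u w} ss → Walk u ss w →
               Σ (SimpleWalk u w) λ p → signedSum D f ss ≋ signedSum D f (steps p)
    shortcut []       refl = record { steps = [] ; walk = refl ; vertices-unique = [] ∷ [] ; arcs-unique = [] } ,
                             ≡⇒≋ refl
    shortcut {w = w} (s ∷ ss) (refl , ss-walk) with shortcut ss ss-walk
    ... | p , ss≋p with any? (stepFrom D s ≟_) (vertices (steps p) w)
    ...   | no s∉ =
      record { steps = s ∷ steps p ; walk = refl , walk p
             ; vertices-unique = Allₚ.¬Any⇒All¬ _ s∉ ∷ vertices-unique p
             ; arcs-unique = Allₚ.¬Any⇒All¬ _ (freshStart⇒freshArc s (steps p) (walk p) s∉) ∷ arcs-unique p } ,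
      ≋-+-cong (≋-refl {stepValue f s}) ss≋p
    ...   | yes s∈ with removeLoop s p s∈
    ...     | p′ , s∷p≋p′ = p′ , ≋-trans (≋-+-cong (≋-refl {stepValue f s}) ss≋p) s∷p≋p′

    closedWalk≋0 : ∀ {u} ss → Walk u ss u → signedSum D f ss ≋ + 0
    closedWalk≋0 ss ss-walk with shortcut ss ss-walk
    ... | p , ss≋p = ≋-trans ss≋p
      (≡⇒≋ (cong (signedSum D f) (closedWalk-unique⇒[] (steps p) (walk p) (vertices-unique p))))

countArcs-cong : ∀ D {p p′ : Fin (nA D) → Bool} → (∀ a → p a ≡ p′ a) → countArcs D p ≡ countArcs D p′
countArcs-cong D {p} {p′} p≗p′ = cong length
  (filter-≐ (λ a → T? (p a)) (λ a → T? (p′ a))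
             ((λ {a} → subst T (p≗p′ a)) , (λ {a} → subst T (sym (p≗p′ a))))
             (allFin (nA D)))

module Potentials (D : Digraph) (n : ℕ) where
  open Walks D

  q : ℕ
  q = suc n

  open Congruence q

  Potential : Set
  Potential = Vec (Fin q) (nV D)

  Labelling : Set
  Labelling = Vec (Fin q) (nA D)

  height : Potential → Vertex → ℤ
  height g v = val (lookup g v)

  difference : Potential → Fin (nA D) → ℤ
  difference g a = height g (end D a) - height g (orig D a)

  tension : Potential → Labelling
  tension g = tabulate (λ a → residue (difference g a))

  val-tension : ∀ g a → val (lookup (tension g) a) ≋ difference g a
  val-tension g a rewrite lookup∘tabulate (λ a → residue (difference g a)) a = val-residue _

  tension-≡ : ∀ g {f} → (∀ a → difference g a ≋ val (lookup f a)) → tension g ≡ f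
  tension-≡ g {f} difference≋f = trans
    (tabulate-cong (λ a → trans (residue-cong (difference≋f a)) (residue-val (lookup f a))))
    (tabulate∘lookup f)

  stepValue-tension : ∀ g s → stepValue (tension g) s ≋ height g (stepTo D s) - height g (stepFrom D s)
  stepValue-tension g (step a true)  = val-tension g a
  stepValue-tension g (step a false) =
    ≋-trans (≋-neg-cong (val-tension g a)) (≡⇒≋ (-[i-j]≡j-i (height g (end D a)) (height g (orig D a))))

  signedSum-tension : ∀ g {x y} ss → Walk x ss y → signedSum D (tension g) ss ≋ height g y - height g x
  signedSum-tension g {x} []       refl           = ≡⇒≋ (sym (ℤₚ.+-inverseʳ (height g x)))
  signedSum-tension g {y = y} (s ∷ ss) (refl , walk) = begin
    stepValue (tension g) s ℤ.+ signedSum D (tension g) ss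
      ≈⟨ ≋-+-cong (stepValue-tension g s) (signedSum-tension g ss walk) ⟩
    (height g (stepTo D s) - height g (stepFrom D s)) ℤ.+ (height g y - height g (stepTo D s))
      ≡⟨ lemma (height g (stepFrom D s)) (height g (stepTo D s)) (height g y) ⟩
    height g y - height g (stepFrom D s)
      ∎
    where
    open import Relation.Binary.Reasoning.Setoid ≋-setoid
    lemma : ∀ x y z → (y - x) ℤ.+ (z - y) ≡ z - x
    lemma = solve-∀

  tension-isCoflow : ∀ g → IsCoflow D q (tension g)
  tension-isCoflow g (s ∷ ss) (chain , _) = ≋0⇒∣ (≋-trans
    (signedSum-tension g (s ∷ ss) (refl , chain⇒walk s ss chain))
    (≡⇒≋ (ℤₚ.+-inverseʳ (height g (stepFrom D s)))))

  tension-≡⇒height-gap-≋ : ∀ {g g′} → tension g ≡ tension g′ → ∀ {x y} ss → Walk x ss y →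
                       height g x - height g′ x ≋ height g y - height g′ y
  tension-≡⇒height-gap-≋ {g} {g′} tg≡tg′ {x} {y} ss walk = begin
    height g x - height g′ x
      ≡⟨ lemma (height g x) (height g′ x) (height g y) (height g′ y) ⟩
    (height g y - height g′ y) ℤ.+ ((height g′ y - height g′ x) - (height g y - height g x))
      ≈⟨ ≋-+-cong (≋-refl {height g y - height g′ y})
                  (≋-+-cong (≋-sym rise≋rise′) (≋-refl { - (height g y - height g x)})) ⟩
    (height g y - height g′ y) ℤ.+ ((height g y - height g x) - (height g y - height g x))
      ≡⟨ lemma′ (height g y - height g′ y) (height g y - height g x) ⟩
    height g y - height g′ y
      ∎
    where
    open import Relation.Binary.Reasoning.Setoid ≋-setoid
    lemma : ∀ x x′ y y′ → x - x′ ≡ (y - y′) ℤ.+ ((y′ - x′) - (y - x))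
    lemma = solve-∀
    lemma′ : ∀ z w → z ℤ.+ (w - w) ≡ z
    lemma′ = solve-∀
    rise≋rise′ : height g y - height g x ≋ height g′ y - height g′ x
    rise≋rise′ = ≋-trans (≋-sym (signedSum-tension g ss walk))
      (subst (λ f → signedSum D f ss ≋ height g′ y - height g′ x) (sym tg≡tg′) (signedSum-tension g′ ss walk))

  inS-label≡posClass-height : ∀ g u v → inS q (label g u - label g v) ≡ posClass q (height g u - height g v)
  inS-label≡posClass-height g u v = begin
    inS q (label g u - label g v)
      ≡⟨ cong (inS q) (lemma (height g u) (height g v)) ⟩
    inS q (height g u - height g v)
      ≡⟨ posClass≡inS n _ (∣+m-+n∣<q (toℕ<n (lookup g u)) (toℕ<n (lookup g v))) ⟨
    posClass q (height g u - height g v)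
      ∎
    where
    open ≡-Reasoning
    lemma : ∀ x y → (+ 1 ℤ.+ x) - (+ 1 ℤ.+ y) ≡ x - y
    lemma = solve-∀

  vPos≡fPos-tension : ∀ g → vPos D q g ≡ fPos D q (tension g)
  vPos≡fPos-tension g = countArcs-cong D λ a →
    trans (inS-label≡posClass-height g (end D a) (orig D a)) (posClass-cong (≋-sym (val-tension g a)))

  vNeg≡fNeg-tension : ∀ g → vNeg D q g ≡ fNeg D q (tension g)
  vNeg≡fNeg-tension g = countArcs-cong D λ a →
    trans (inS-label≡posClass-height g (orig D a) (end D a)) (posClass-cong (≋-sym (neg-val-tension a)))
    where
    neg-val-tension : ∀ a → - val (lookup (tension g) a) ≋ height g (orig D a) - height g (end D a)
    neg-val-tension a =
      ≋-trans (≋-neg-cong (val-tension g a)) (≡⇒≋ (-[i-j]≡j-i (height g (end D a)) (height g (orig D a))))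

module Components (D : Digraph) (n nc : ℕ) (κ : Fin (nV D) → Fin nc)
                  (κ-surjective : ∀ i → ∃ λ v → κ v ≡ i)
                  (κ-components : ∀ u v → (κ u ≡ κ v) ⇔ Connected D u v) where
  open Walks D
  open Potentials D n public
  open Congruence q

  root : Fin nc → Vertex
  root i = proj₁ (κ-surjective i)

  rootWalk : ∀ v → ∃ λ ss → Walk (root (κ v)) ss v
  rootWalk v = connected⇒walk (Equivalence.to (κ-components (root (κ v)) v) (proj₂ (κ-surjective (κ v))))

  κ-arc : ∀ a → κ (orig D a) ≡ κ (end D a)
  κ-arc a = Equivalence.from (κ-components (orig D a) (end D a)) ((a , inj₁ (refl , refl)) ◅ ε)

  integrate : Labelling → Vertex → ℤ
  integrate f v = signedSum D f (proj₁ (rootWalk v))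

  potential : Labelling → Potential
  potential f = tabulate (λ v → residue (integrate f v))

  height-potential : ∀ f v → height (potential f) v ≋ integrate f v
  height-potential f v rewrite lookup∘tabulate (λ v → residue (integrate f v)) v = val-residue _

  integrate-difference : ∀ {f} → IsCoflow D q f → ∀ a →
                         integrate f (end D a) - integrate f (orig D a) ≋ val (lookup f a)
  integrate-difference {f} f-coflow a = begin
    integrate f e - integrate f o                  ≡⟨ lemma (integrate f o) (val (lookup f a)) (integrate f e) ⟩
    val (lookup f a) - (integrate f o ℤ.+ (val (lookup f a) - integrate f e))
                                                   ≡⟨ cong (λ t → val (lookup f a) - t) loop-sum ⟨
    val (lookup f a) - signedSum D f loop          ≈⟨ ≋-+-cong (≋-refl {val (lookup f a)}) (≋-neg-cong loop≋0) ⟩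
    val (lookup f a) - + 0                         ≡⟨ ℤₚ.+-identityʳ (val (lookup f a)) ⟩
    val (lookup f a)                               ∎
    where
    open import Relation.Binary.Reasoning.Setoid ≋-setoid
    o e : Vertex
    o = orig D a
    e = end D a
    lemma : ∀ x y z → z - x ≡ y - (x ℤ.+ (y - z))
    lemma = solve-∀
    loop : List (Step D)
    loop = proj₁ (rootWalk o) ++ step a true ∷ reverseWalk (proj₁ (rootWalk e))
    loop-walk : Walk (root (κ o)) loop (root (κ o))
    loop-walk = subst (Walk (root (κ o)) loop) (cong root (sym (κ-arc a)))
      (walk-++ (proj₁ (rootWalk o)) (proj₂ (rootWalk o)) (refl , walk-reverse _ (proj₂ (rootWalk e))))
    loop-sum : signedSum D f loop ≡ integrate f o ℤ.+ (val (lookup f a) - integrate f e)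
    loop-sum = trans (signedSum-++ f (proj₁ (rootWalk o)) _)
      (cong (λ t → integrate f o ℤ.+ (val (lookup f a) ℤ.+ t)) (signedSum-reverseWalk f (proj₁ (rootWalk e))))
    loop≋0 : signedSum D f loop ≋ + 0
    loop≋0 = ClosedWalks.closedWalk≋0 D f (λ C C-cycle → ∣⇒≋0 (f-coflow C C-cycle)) loop loop-walk

  tension-potential : ∀ f → IsCoflow D q f → tension (potential f) ≡ f
  tension-potential f f-coflow = tension-≡ (potential f) λ a → ≋-trans
    (≋-+-cong (height-potential f (end D a)) (≋-neg-cong (height-potential f (orig D a))))
    (integrate-difference f-coflow a)

  shift : Potential → Vec (Fin q) nc → Potential
  shift g c = tabulate (λ v → residue (height g v ℤ.+ val (lookup c (κ v))))

  height-shift : ∀ g c v → height (shift g c) v ≋ height g v ℤ.+ val (lookup c (κ v))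
  height-shift g c v rewrite lookup∘tabulate (λ v → residue (height g v ℤ.+ val (lookup c (κ v)))) v =
    val-residue _

  difference-shift : ∀ g c a → difference (shift g c) a ≋ difference g a
  difference-shift g c a = begin
    difference (shift g c) a
      ≈⟨ ≋-+-cong (height-shift g c e) (≋-neg-cong (height-shift g c o)) ⟩
    (height g e ℤ.+ cₑ) - (height g o ℤ.+ val (lookup c (κ o)))
      ≡⟨ cong (λ i → (height g e ℤ.+ cₑ) - (height g o ℤ.+ val (lookup c i))) (κ-arc a) ⟩
    (height g e ℤ.+ cₑ) - (height g o ℤ.+ cₑ)
      ≡⟨ lemma (height g e) (height g o) cₑ ⟩
    difference g a
      ∎
    where
    open import Relation.Binary.Reasoning.Setoid ≋-setoid
    o e : Vertex
    o = orig D a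
    e = end D a
    cₑ : ℤ
    cₑ = val (lookup c (κ e))
    lemma : ∀ x y z → (x ℤ.+ z) - (y ℤ.+ z) ≡ x - y
    lemma = solve-∀

  tension-shift : ∀ g c → tension (shift g c) ≡ tension g
  tension-shift g c = tension-≡ (shift g c) λ a → ≋-trans (difference-shift g c a) (≋-sym (val-tension g a))

  shift-injective : ∀ g {c c′} → shift g c ≡ shift g c′ → c ≡ c′
  shift-injective g {c} {c′} shift≡ = lookup-extensionality λ i →
    subst (λ j → lookup c j ≡ lookup c′ j) (proj₂ (κ-surjective i)) (val-injective (c≋c′ (root i)))
    where
    open import Relation.Binary.Reasoning.Setoid ≋-setoid
    c≋c′ : ∀ v → val (lookup c (κ v)) ≋ val (lookup c′ (κ v))
    c≋c′ v = ≋-+-cancelˡ (height g v) (begin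
      height g v ℤ.+ val (lookup c (κ v))   ≈⟨ height-shift g c v ⟨
      height (shift g c) v                  ≡⟨ cong (λ g′ → height g′ v) shift≡ ⟩
      height (shift g c′) v                 ≈⟨ height-shift g c′ v ⟩
      height g v ℤ.+ val (lookup c′ (κ v))  ∎)

  offset : Potential → Vec (Fin q) nc
  offset g = tabulate (λ i → residue (height g (root i) - height (potential (tension g)) (root i)))

  shift-offset : ∀ g → shift (potential (tension g)) (offset g) ≡ g
  shift-offset g = lookup-extensionality λ v → val-injective {lookup (shift P (offset g)) v} (begin
    height (shift P (offset g)) v                ≈⟨ height-shift P (offset g) v ⟩
    height P v ℤ.+ val (lookup (offset g) (κ v)) ≈⟨ ≋-+-cong (≋-refl {height P v}) (val-offset (κ v)) ⟩
    height P v ℤ.+ (height g (root (κ v)) - height P (root (κ v)))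
      ≈⟨ ≋-+-cong (≋-refl {height P v}) (tension-≡⇒height-gap-≋ {g} {P} tg≡tP _ (proj₂ (rootWalk v))) ⟩
    height P v ℤ.+ (height g v - height P v)     ≡⟨ lemma (height P v) (height g v) ⟩
    height g v                                   ∎)
    where
    open import Relation.Binary.Reasoning.Setoid ≋-setoid
    P : Potential
    P = potential (tension g)
    tg≡tP : tension g ≡ tension P
    tg≡tP = sym (tension-potential (tension g) (tension-isCoflow g))
    val-offset : ∀ i → val (lookup (offset g) i) ≋ height g (root i) - height P (root i)
    val-offset i rewrite lookup∘tabulate (λ i → residue (height g (root i) - height P (root i))) i = val-residue _
    lemma : ∀ x y → x ℤ.+ (y - x) ≡ y
    lemma = solve-∀

  -- (f , c) ↦ lift f c is a bijection from coflows × (ℤ/q)^nc onto potentials, with inverse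
  -- g ↦ (tension g , offset g).
  lift : Labelling → Vec (Fin q) nc → Potential
  lift f c = shift (potential f) c

  tension-lift : ∀ {f} c → IsCoflow D q f → tension (lift f c) ≡ f
  tension-lift {f} c f-coflow = trans (tension-shift (potential f) c) (tension-potential f f-coflow)

  lift-injective : ∀ {f f′ c c′} → IsCoflow D q f → IsCoflow D q f′ →
                   lift f c ≡ lift f′ c′ → f ≡ f′ × c ≡ c′
  lift-injective {f} {f′} {c} {c′} f-coflow f′-coflow lift≡ =
    f≡f′ , shift-injective (potential f) (trans lift≡ (cong (λ h → lift h c′) (sym f≡f′)))
    where
    f≡f′ : f ≡ f′
    f≡f′ = trans (sym (tension-lift c f-coflow)) (trans (cong tension lift≡) (tension-lift c′ f′-coflow))

  lifts-unique : ∀ {L} → Unique L → (∀ {f} → f ∈ L → IsCoflow D q f) →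
                 Unique (cartesianProductWith lift L (allVecs nc q))
  lifts-unique L! coflow = Unique-cartesianProductWith⁺-on lift
    (λ f∈L f′∈L _ _ → lift-injective (coflow f∈L) (coflow f′∈L)) L! (allVecs-unique q nc)

  ∈-lifts : ∀ {L} → (∀ {f} → IsCoflow D q f → f ∈ L) →
            ∀ g → g ∈ cartesianProductWith lift L (allVecs nc q)
  ∈-lifts {L} coflow∈L g = subst (_∈ cartesianProductWith lift L (allVecs nc q)) (shift-offset g)
    (∈-cartesianProductWith⁺ lift (coflow∈L (tension-isCoflow g)) (∈-allVecs q (offset g)))

  lifts↭potentials : ∀ {L} → Unique L → (∀ f → (f ∈ L) ⇔ IsCoflow D q f) →
                     cartesianProductWith lift L (allVecs nc q) ↭ allVecs (nV D) q
  lifts↭potentials {L} L! L⇔coflow = ∼bag⇒↭ (unique∧set⇒bag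
    (lifts-unique L! (Equivalence.to (L⇔coflow _)))
    (allVecs-unique q (nV D))
    (λ {g} → mk⇔ (λ _ → ∈-allVecs q g) (λ _ → ∈-lifts (Equivalence.from (L⇔coflow _)) g)))

proposition3p6 : ∀ {c ℓ} (R : CommutativeRing c ℓ) (D : Digraph)
    (nc : ℕ) (κ : Fin (nV D) → Fin nc)
    → (∀ i → ∃ λ v → κ v ≡ i)
    → (∀ u v → (κ u ≡ κ v) ⇔ Connected D u v)
    → (k : ℕ)
    → (L : List (Vec (Fin (suc (2 * k))) (nA D)))
    → Unique L
    → (∀ f → (f ∈ L) ⇔ IsCoflow D (suc (2 * k)) f)
    → ∀ (y z : CommutativeRing.Carrier R)
    → CommutativeRing._≈_ R
        (natMul R (suc (2 * k) ^ nc) (coflowSum R D (suc (2 * k)) L y z))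
        (vertexSum R D (suc (2 * k)) y z)
proposition3p6 R D nc κ κ-surjective κ-components k L L! L⇔coflow y z = begin
  natMul R (q ^ nc) (∑ L arcMonomial)
    ≡⟨ cong (λ N → natMul R N (∑ L arcMonomial)) (length-allVecs q nc) ⟨
  natMul R (length (allVecs nc q)) (∑ L arcMonomial)
    ≈⟨ ∑-uniformFibres vertexMonomial arcMonomial lift (lifts↭potentials L! L⇔coflow) monomial-lift ⟨
  ∑ (allVecs (nV D) q) vertexMonomial
    ∎
  where
  open Components D (2 * k) nc κ κ-surjective κ-components
  open Sums R
  open CommutativeRing R using (Carrier; _≈_; setoid; reflexive)
  module R = CommutativeRing R
  open import Relation.Binary.Reasoning.Setoid setoid

  monomial : ℕ → ℕ → Carrier
  monomial m n = (_^ᴿ_ R y m) R.* (_^ᴿ_ R z n)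

  arcMonomial : Labelling → Carrier
  arcMonomial f = monomial (fPos D q f) (fNeg D q f)

  vertexMonomial : Potential → Carrier
  vertexMonomial g = monomial (vPos D q g) (vNeg D q g)

  monomial-lift : ∀ {f} c → f ∈ L → vertexMonomial (lift f c) ≈ arcMonomial f
  monomial-lift {f} c f∈L = reflexive (trans
    (cong₂ monomial (vPos≡fPos-tension (lift f c)) (vNeg≡fNeg-tension (lift f c)))
    (cong arcMonomial (tension-lift c (Equivalence.to (L⇔coflow f) f∈L))))
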